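{- For the ratio group Steiner problem on a rooted tree, the optimal value of the linear program $$\min \sum_{e\in E} d_e x_e$$ subject to: $x_e\le x_{\pi(e)}$ for all $e\in E$ having a parent edge; $f^i_e=\sum_{e':\pi(e')=e} f^i_{e'}$ for all $i\in[k]$ and all $e\in E\setminus\{\pi(v):v\in S_i\}$; $\sum_{v\in S_i} f^i_{\pi(v)}=y_i$ for all $i\in[k]$; $f^i_e\le x_e$ for all $e\in E$, $i\in[k]$; $\sum_{i=1}^k w_i y_i\ge1$; $x,f,y\ge0$, is at most the minimum, over subtrees $T$ of $G$ containing $r$ and covering at least one group, of $d(T)/\mathrm{cov}(T)$.
   Context: $G=(V,E)$ is a tree rooted at $r$ with edge lengths $d_e\ge0$; edges are directed away from $r$; for an edge $e$, $\pi(e)$ is its parent edge (if any), and for a node $v\ne r$, $\pi(v)$ is the edge entering $v$ from its parent. There are $k$ groups $S_i\subseteq V$ with weights $w_i\ge1$; standing assumptions: the groups are pairwise disjoint, and no two nodes of the same group are in an ancestor–descendant relation. A subtree $T$ containing $r$ covers group $i$ if $T\cap S_i\ne\emptyset$; $d(T)=\sum_{e\in T}d_e$ and $\mathrm{cov}(T)=\sum_{i\text{ covered}}w_i$.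
   Formalization: The edge lengths $d_e$ and group weights $w_i$ are rational rather than real, and the variables x, f, y of the linear program are taken in the rationals. -}

module Defs where

open import Data.Nat using (ℕ; zero; suc)
open import Data.Fin using (Fin; zero; suc)
open import Data.Bool using (Bool; true; false; if_then_else_; _∧_)
open import Data.List using (List; foldr; allFin)
open import Data.Bool.ListAction using (any)
open import Data.Product using (∃; _×_)
open import Data.Rational using (ℚ; 0ℚ; _+_; _÷_; ≢-nonZero)
open import Data.Rational.Properties using (_≟_)
open import Relation.Nullary using (yes; no; ¬_)
open import Relation.Binary.PropositionalEquality using (_≡_)

-- A rooted tree on nodes Fin (suc n): node zero is the root r, and the
-- non-root node (suc j) has parent (par j).  Edges are indexed by Fin n:
-- edge j is the edge π(suc j) entering node suc j from its parent.

up : ∀ {n} → (Fin n → Fin (suc n)) → Fin (suc n) → Fin (suc n)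
up par zero    = zero
up par (suc j) = par j

iter : ∀ {n} → (Fin n → Fin (suc n)) → ℕ → Fin (suc n) → Fin (suc n)
iter par zero    v = v
iter par (suc m) v = up par (iter par m v)

IsTree : ∀ {n} → (Fin n → Fin (suc n)) → Set
IsTree par = ∀ v → ∃ λ m → iter par m v ≡ zero

ProperAnc : ∀ {n} → (Fin n → Fin (suc n)) → Fin (suc n) → Fin (suc n) → Set
ProperAnc par u v = ∃ λ m → iter par (suc m) v ≡ u

Σℚ : ∀ {m} → (Fin m → ℚ) → ℚ
Σℚ {m} g = foldr (λ i acc → g i + acc) 0ℚ (allFin m)

-- sum of g over the edges e' whose parent edge is edge j
-- (i.e. edges entering children of node suc j)
childSum : ∀ {n} → (Fin n → Fin (suc n)) → (Fin n → ℚ) → Fin n → ℚ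
childSum par g j = Σℚ (λ j' → if isYes (par j' Data.Fin.≟ suc j) then g j' else 0ℚ)
  where open import Relation.Nullary.Decidable using (isYes)

IsRootedSubtree : ∀ {n} → (Fin n → Fin (suc n)) → (Fin (suc n) → Bool) → Set
IsRootedSubtree par T = (T zero ≡ true) × (∀ j → T (suc j) ≡ true → T (par j) ≡ true)

-- d(T): total length of the edges of T (edge j belongs to T iff suc j ∈ T)
dist : ∀ {n} → (Fin n → ℚ) → (Fin (suc n) → Bool) → ℚ
dist d T = Σℚ (λ j → if T (suc j) then d j else 0ℚ)

covers : ∀ {n k} → (Fin k → Fin (suc n) → Bool) → (Fin (suc n) → Bool) → Fin k → Bool
covers {n} S T i = any (λ v → T v ∧ S i v) (allFin (suc n))

cov : ∀ {n k} → (Fin k → Fin (suc n) → Bool) → (Fin k → ℚ) → (Fin (suc n) → Bool) → ℚ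
cov S w T = Σℚ (λ i → if covers S T i then w i else 0ℚ)

-- a / b  (b ≠ 0 in all uses; defined as 0 when b = 0)
ratio : ℚ → ℚ → ℚ
ratio a b with b ≟ 0ℚ
... | yes _  = 0ℚ
... | no b≢0 = _÷_ a b {{≢-nonZero b≢0}}

if' : Bool → ℚ → ℚ
if' b q = if b then q else 0ℚ

-- Put c = 1 / cov(T) on every edge of T.  For each covered group i pick a
-- node vᵢ ∈ T ∩ Sᵢ and send a flow of value c along the root–vᵢ path: on a
-- path every edge other than the last one has exactly one child edge on the
-- path, so flow is conserved, and since Sᵢ is an antichain the path enters
-- Sᵢ only at vᵢ.  Then Σᵢ wᵢ yᵢ = c · cov(T) = 1 and Σₑ dₑ xₑ = c · d(T).
-- Uniqueness of the child edge is where acyclicity enters: a walk towards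
-- the root that revisits a node is periodic, and a periodic walk can only
-- reach the root if it starts there.
module Submission where

open import Defs
open import Data.Nat as ℕ using (ℕ; zero; suc; _∸_; s≤s; _≤?_)
import Data.Nat.Properties as ℕₚ
open import Data.Fin using (Fin; zero; suc; toℕ; fromℕ; fromℕ<)
import Data.Fin.Properties as Finₚ
open import Data.Bool using (Bool; true; false; if_then_else_; _∧_)
open import Data.Bool.Properties using (∧-conicalˡ; ∧-conicalʳ)
open import Data.Bool.ListAction using (any)
open import Data.List using (List; []; _∷_; foldr; tabulate; allFin)
open import Data.Product using (∃; _×_; _,_; proj₁; proj₂)
open import Data.Rational using (ℚ; 0ℚ; 1ℚ; _≤_; _<_; _*_; _+_; 1/_; NonNegative; ≢-nonZero; positive)
import Data.Rational.Properties as ℚₚ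
open import Algebra.Bundles using (Ring)
open import Algebra.Properties.Semiring.Sum (Ring.semiring ℚₚ.+-*-ring)
  using (sum; sum-cong-≗; sum-replicate-zero; *-distribˡ-sum)
open import Relation.Nullary using (¬_; Dec; yes; no; does)
open import Relation.Nullary.Decidable using (map′; isYes; dec-true; dec-false)
open import Relation.Binary.Definitions using (tri<; tri≈; tri>)
open import Relation.Binary.PropositionalEquality
  using (_≡_; _≢_; refl; sym; trans; cong; subst; module ≡-Reasoning)
open import Data.Empty using (⊥-elim)
open import Function using (_∘_; id)

open ≡-Reasoning

foldr-tabulate≡sum : ∀ {m} {A : Set} (g : A → ℚ) (h : Fin m → A) →
                     foldr (λ a acc → g a + acc) 0ℚ (tabulate h) ≡ sum (g ∘ h)
foldr-tabulate≡sum {zero}  g h = refl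
foldr-tabulate≡sum {suc m} g h = cong (g (h zero) +_) (foldr-tabulate≡sum g (h ∘ suc))

Σℚ≡sum : ∀ {m} (g : Fin m → ℚ) → Σℚ g ≡ sum g
Σℚ≡sum g = foldr-tabulate≡sum g id

Σℚ-cong : ∀ {m} {g h : Fin m → ℚ} → (∀ j → g j ≡ h j) → Σℚ g ≡ Σℚ h
Σℚ-cong {g = g} {h} g≗h = trans (Σℚ≡sum g) (trans (sum-cong-≗ g≗h) (sym (Σℚ≡sum h)))

Σℚ-zero : ∀ {m} {g : Fin m → ℚ} → (∀ j → g j ≡ 0ℚ) → Σℚ g ≡ 0ℚ
Σℚ-zero {m} {g} g≗0 = trans (Σℚ≡sum g) (trans (sum-cong-≗ g≗0) (sum-replicate-zero m))

sum-single : ∀ {m} (g : Fin m → ℚ) j₀ → (∀ j → j ≢ j₀ → g j ≡ 0ℚ) → sum g ≡ g j₀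
sum-single {suc m} g zero others = begin
  g zero + sum (g ∘ suc)      ≡⟨ cong (g zero +_) (sum-cong-≗ (λ j → others (suc j) λ ())) ⟩
  g zero + sum {m} (λ _ → 0ℚ) ≡⟨ cong (g zero +_) (sum-replicate-zero m) ⟩
  g zero + 0ℚ                 ≡⟨ ℚₚ.+-identityʳ (g zero) ⟩
  g zero                      ∎
sum-single g (suc j₀) others = begin
  g zero + sum (g ∘ suc) ≡⟨ cong (_+ sum (g ∘ suc)) (others zero λ ()) ⟩
  0ℚ + sum (g ∘ suc)     ≡⟨ ℚₚ.+-identityˡ _ ⟩
  sum (g ∘ suc)          ≡⟨ sum-single (g ∘ suc) j₀ (λ j j≢j₀ →
                              others (suc j) (j≢j₀ ∘ Finₚ.suc-injective)) ⟩
  g (suc j₀)             ∎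

Σℚ-single : ∀ {m} (g : Fin m → ℚ) j₀ → (∀ j → j ≢ j₀ → g j ≡ 0ℚ) → Σℚ g ≡ g j₀
Σℚ-single g j₀ others = trans (Σℚ≡sum g) (sum-single g j₀ others)

sum-nonneg : ∀ {m} (g : Fin m → ℚ) → (∀ j → 0ℚ ≤ g j) → 0ℚ ≤ sum g
sum-nonneg {zero}  g g≥0 = ℚₚ.≤-refl
sum-nonneg {suc m} g g≥0 = ℚₚ.+-mono-≤ (g≥0 zero) (sum-nonneg (g ∘ suc) (g≥0 ∘ suc))

term≤sum : ∀ {m} (g : Fin m → ℚ) → (∀ j → 0ℚ ≤ g j) → ∀ j → g j ≤ sum g
term≤sum g g≥0 zero =
  subst (_≤ sum g) (ℚₚ.+-identityʳ (g zero))
        (ℚₚ.+-monoʳ-≤ (g zero) (sum-nonneg (g ∘ suc) (g≥0 ∘ suc)))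
term≤sum g g≥0 (suc j) =
  subst (_≤ sum g) (ℚₚ.+-identityˡ (g (suc j)))
        (ℚₚ.+-mono-≤ (g≥0 zero) (term≤sum (g ∘ suc) (g≥0 ∘ suc) j))

term≤Σℚ : ∀ {m} (g : Fin m → ℚ) → (∀ j → 0ℚ ≤ g j) → ∀ j → g j ≤ Σℚ g
term≤Σℚ g g≥0 j = subst (g j ≤_) (sym (Σℚ≡sum g)) (term≤sum g g≥0 j)

Σℚ-*-distribˡ : ∀ {m} c (g : Fin m → ℚ) → Σℚ (λ j → c * g j) ≡ c * Σℚ g
Σℚ-*-distribˡ c g = begin
  Σℚ (λ j → c * g j)  ≡⟨ Σℚ≡sum (λ j → c * g j) ⟩
  sum (λ j → c * g j) ≡⟨ sym (*-distribˡ-sum c g) ⟩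
  c * sum g           ≡⟨ cong (c *_) (sym (Σℚ≡sum g)) ⟩
  c * Σℚ g            ∎

if'-true : ∀ {b} {q} → b ≡ true → if' b q ≡ q
if'-true refl = refl

if'-cong : ∀ b {p q} → (b ≡ true → p ≡ q) → if' b p ≡ if' b q
if'-cong true  p≡q = p≡q refl
if'-cong false p≡q = refl

if'-nonneg : ∀ b {q} → 0ℚ ≤ q → 0ℚ ≤ if' b q
if'-nonneg true  q≥0 = q≥0
if'-nonneg false q≥0 = ℚₚ.≤-refl

if'-≤ : ∀ b {p q} → (b ≡ true → p ≤ q) → 0ℚ ≤ q → if' b p ≤ q
if'-≤ true  p≤q q≥0 = p≤q refl
if'-≤ false p≤q q≥0 = q≥0

if'-comm : ∀ b b' q → if' b (if' b' q) ≡ if' b' (if' b q)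
if'-comm true  b' q = refl
if'-comm false true  q = refl
if'-comm false false q = refl

*-if'-comm : ∀ b p q → p * if' b q ≡ q * if' b p
*-if'-comm true  p q = ℚₚ.*-comm p q
*-if'-comm false p q = trans (ℚₚ.*-zeroʳ p) (sym (ℚₚ.*-zeroʳ q))

Σℚ-if' : ∀ {m} b (g : Fin m → ℚ) → Σℚ (λ j → if' b (g j)) ≡ if' b (Σℚ g)
Σℚ-if' true  g = refl
Σℚ-if' {m} false g = Σℚ-zero {m} {λ _ → 0ℚ} (λ _ → refl)

Σℚ-*-if' : ∀ {m} (b : Fin m → Bool) (p : Fin m → ℚ) q →
           Σℚ (λ j → p j * if' (b j) q) ≡ q * Σℚ (λ j → if' (b j) (p j))
Σℚ-*-if' b p q =
  trans (Σℚ-cong (λ j → *-if'-comm (b j) (p j) q)) (Σℚ-*-distribˡ q (λ j → if' (b j) (p j)))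

childSum-if' : ∀ {n} (par : Fin n → Fin (suc n)) b (h : Fin n → ℚ) j →
               childSum par (λ j' → if' b (h j')) j ≡ if' b (childSum par h j)
childSum-if' {n} par b h j =
  trans (Σℚ-cong (λ j' → if'-comm (child j') b (h j'))) (Σℚ-if' b (λ j' → if' (child j') (h j')))
  where
  child : Fin n → Bool
  child j' = isYes (par j' Finₚ.≟ suc j)

ratio-1-nonneg : ∀ b → 0ℚ < b → 0ℚ ≤ ratio 1ℚ b
ratio-1-nonneg b b>0 with b ℚₚ.≟ 0ℚ
... | yes _  = ℚₚ.≤-refl
... | no b≢0 = subst (0ℚ ≤_) (sym (ℚₚ.*-identityˡ 1/b)) (ℚₚ.nonNegative⁻¹ 1/b {{1/b≥0}})
  where
  1/b : ℚ
  1/b = (1/ b) {{≢-nonZero b≢0}}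
  1/b≥0 : NonNegative 1/b
  1/b≥0 = ℚₚ.pos⇒nonNeg 1/b {{ℚₚ.1/pos⇒pos b {{positive b>0}}}}

ratio-1-inverseˡ : ∀ b → b ≢ 0ℚ → ratio 1ℚ b * b ≡ 1ℚ
ratio-1-inverseˡ b b≢0 with b ℚₚ.≟ 0ℚ
... | yes b≡0 = ⊥-elim (b≢0 b≡0)
... | no b≢0 =
  trans (cong (_* b) (ℚₚ.*-identityˡ ((1/ b) {{≢-nonZero b≢0}})))
        (ℚₚ.*-inverseˡ b {{≢-nonZero b≢0}})

ratio-1-* : ∀ b a → ratio 1ℚ b * a ≡ ratio a b
ratio-1-* b a with b ℚₚ.≟ 0ℚ
... | yes _  = ℚₚ.*-zeroˡ a
... | no b≢0 = let 1/b = (1/ b) {{≢-nonZero b≢0}} in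
  trans (cong (_* a) (ℚₚ.*-identityˡ 1/b)) (ℚₚ.*-comm 1/b a)

firstOr : ∀ {A : Set} → (A → Bool) → A → List A → A
firstOr p d []       = d
firstOr p d (x ∷ xs) = if p x then x else firstOr p d xs

firstOr-satisfies : ∀ {A : Set} (p : A → Bool) d xs → any p xs ≡ true → p (firstOr p d xs) ≡ true
firstOr-satisfies p d (x ∷ xs) hit with p x in px
... | true  = px
... | false = firstOr-satisfies p d xs hit

module RootedTree {n : ℕ} (par : Fin n → Fin (suc n)) (tree : IsTree par) where

  iter-+ : ∀ p q v → iter par (p ℕ.+ q) v ≡ iter par p (iter par q v)
  iter-+ zero    q v = refl
  iter-+ (suc p) q v = cong (up par) (iter-+ p q v)

  iter-root : ∀ m → iter par m zero ≡ zero
  iter-root zero    = refl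
  iter-root (suc m) = cong (up par) (iter-root m)

  iter-beyond : ∀ {D v t} → iter par D v ≡ zero → D ℕ.≤ t → iter par t v ≡ zero
  iter-beyond {D} {v} {t} reach D≤t = begin
    iter par t v                    ≡⟨ cong (λ s → iter par s v) (sym (ℕₚ.m∸n+n≡m D≤t)) ⟩
    iter par (t ∸ D ℕ.+ D) v        ≡⟨ iter-+ (t ∸ D) D v ⟩
    iter par (t ∸ D) (iter par D v) ≡⟨ cong (iter par (t ∸ D)) reach ⟩
    iter par (t ∸ D) zero           ≡⟨ iter-root (t ∸ D) ⟩
    zero                            ∎

  iter-periodic : ∀ {q x} → iter par q x ≡ x → ∀ t → iter par (t ℕ.* q) x ≡ x
  iter-periodic         cycle zero    = refl
  iter-periodic {q} {x} cycle (suc t) =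
    trans (iter-+ q (t ℕ.* q) x) (trans (cong (iter par q) (iter-periodic cycle t)) cycle)

  cycle⇒root : ∀ {p x} → iter par (suc p) x ≡ x → x ≡ zero
  cycle⇒root {p} {x} cycle with tree x
  ... | D , reach = trans (sym (iter-periodic cycle D)) (iter-beyond reach (ℕₚ.m≤m*n D (suc p)))

  iter-repeat⇒root : ∀ v {a b} → a ℕ.< b → iter par a v ≡ iter par b v → iter par a v ≡ zero
  iter-repeat⇒root v {a} {b} a<b repeat = cycle⇒root {b ∸ suc a} (begin
    iter par (suc (b ∸ suc a)) (iter par a v) ≡⟨ sym (iter-+ (suc (b ∸ suc a)) a v) ⟩
    iter par (suc (b ∸ suc a) ℕ.+ a) v        ≡⟨ cong (λ s → iter par s v) b≡ ⟩
    iter par b v                              ≡⟨ sym repeat ⟩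
    iter par a v                              ∎)
    where
    b≡ : suc (b ∸ suc a) ℕ.+ a ≡ b
    b≡ = trans (sym (ℕₚ.+-suc (b ∸ suc a) a)) (ℕₚ.m∸n+n≡m a<b)

  iter-injective : ∀ v {a b} → iter par a v ≡ iter par b v → iter par a v ≢ zero → a ≡ b
  iter-injective v {a} {b} same nonroot with ℕₚ.<-cmp a b
  ... | tri< a<b _ _ = ⊥-elim (nonroot (iter-repeat⇒root v a<b same))
  ... | tri≈ _ a≡b _ = a≡b
  ... | tri> _ _ b<a = ⊥-elim (nonroot (trans same (iter-repeat⇒root v b<a (sym same))))

  Reaches : Fin (suc n) → Fin (suc n) → Set
  Reaches v u = ∃ λ t → iter par t v ≡ u

  -- Once the walk from v has hit the root (after D steps) it stays there,
  -- so it suffices to search t ≤ D.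
  reaches? : ∀ v u → Dec (Reaches v u)
  reaches? v u with tree v
  ... | D , reach = map′ (λ (t , e) → toℕ t , e) bounded
                         (Finₚ.any? λ (t : Fin (suc D)) → iter par (toℕ t) v Finₚ.≟ u)
    where
    bounded : Reaches v u → ∃ λ (t : Fin (suc D)) → iter par (toℕ t) v ≡ u
    bounded (t , e) with t ≤? D
    ... | yes t≤D =
      fromℕ< (s≤s t≤D) , trans (cong (λ s → iter par s v) (Finₚ.toℕ-fromℕ< (s≤s t≤D))) e
    ... | no t≰D  = fromℕ D , (begin
      iter par (toℕ (fromℕ D)) v ≡⟨ cong (λ s → iter par s v) (Finₚ.toℕ-fromℕ D) ⟩
      iter par D v               ≡⟨ reach ⟩
      zero                       ≡⟨ sym (iter-beyond reach (ℕₚ.<⇒≤ (ℕₚ.≰⇒> t≰D))) ⟩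
      iter par t v               ≡⟨ e ⟩
      u                          ∎)

  reaches-parent : ∀ {v} j → Reaches v (suc j) → Reaches v (par j)
  reaches-parent j (t , e) = suc t , cong (up par) e

  up≡suc⇒child : ∀ u {j} → up par u ≡ suc j → ∃ λ j₀ → u ≡ suc j₀ × par j₀ ≡ suc j
  up≡suc⇒child (suc j₀) e = j₀ , refl , e

  path-child : ∀ {v j} → v ≢ suc j → Reaches v (suc j) →
               ∃ λ j₀ → par j₀ ≡ suc j × Reaches v (suc j₀)
  path-child v≢suc-j (zero  , e) = ⊥-elim (v≢suc-j e)
  path-child {v} v≢suc-j (suc t , e) with up≡suc⇒child (iter par t v) e
  ... | j₀ , e₀ , p = j₀ , p , (t , e₀)

  path-child-unique : ∀ {v j j₁ j₂} → par j₁ ≡ suc j → par j₂ ≡ suc j →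
                      Reaches v (suc j₁) → Reaches v (suc j₂) → j₁ ≡ j₂
  path-child-unique {v} p₁ p₂ (a , e₁) (b , e₂) with iter-injective v {suc a} {suc b} same nonroot
    where
    same : iter par (suc a) v ≡ iter par (suc b) v
    same = trans (cong (up par) e₁) (trans p₁ (sym (trans (cong (up par) e₂) p₂)))
    nonroot : iter par (suc a) v ≢ zero
    nonroot root = Finₚ.0≢1+n (trans (sym root) (trans (cong (up par) e₁) p₁))
  ... | refl = Finₚ.suc-injective (trans (sym e₁) e₂)

  onPath : Fin (suc n) → Fin n → Bool
  onPath v j = does (reaches? v (suc j))

  pathFlow : Fin (suc n) → ℚ → Fin n → ℚ
  pathFlow v a j = if' (onPath v j) a

  pathFlow-on : ∀ {v a j} → Reaches v (suc j) → pathFlow v a j ≡ a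
  pathFlow-on {v} {a} {j} r = cong (λ b → if' b a) (dec-true (reaches? v (suc j)) r)

  pathFlow-off : ∀ {v a j} → ¬ Reaches v (suc j) → pathFlow v a j ≡ 0ℚ
  pathFlow-off {v} {a} {j} ¬r = cong (λ b → if' b a) (dec-false (reaches? v (suc j)) ¬r)

  onPath-sound : ∀ v j → onPath v j ≡ true → Reaches v (suc j)
  onPath-sound v j on with reaches? v (suc j)
  ... | yes r  = r
  ... | no  ¬r with () ← trans (sym on) (dec-false (reaches? v (suc j)) ¬r)

  childSum-pathFlow-off : ∀ {v a j} → ¬ Reaches v (suc j) → childSum par (pathFlow v a) j ≡ 0ℚ
  childSum-pathFlow-off {v} {a} {j} ¬r = Σℚ-zero term
    where
    term : ∀ j' → (if isYes (par j' Finₚ.≟ suc j) then pathFlow v a j' else 0ℚ) ≡ 0ℚ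
    term j' with par j' Finₚ.≟ suc j
    ... | no  _ = refl
    ... | yes p = pathFlow-off (¬r ∘ subst (Reaches v) p ∘ reaches-parent j')

  childSum-pathFlow-on : ∀ {v a j} → v ≢ suc j → Reaches v (suc j) → childSum par (pathFlow v a) j ≡ a
  childSum-pathFlow-on {v} {a} {j} v≢suc-j r with path-child v≢suc-j r
  ... | j₀ , p₀ , r₀ = trans (Σℚ-single _ j₀ others) self
    where
    self : (if isYes (par j₀ Finₚ.≟ suc j) then pathFlow v a j₀ else 0ℚ) ≡ a
    self with par j₀ Finₚ.≟ suc j
    ... | yes _   = pathFlow-on r₀
    ... | no  ¬p₀ = ⊥-elim (¬p₀ p₀)
    others : ∀ j' → j' ≢ j₀ →
             (if isYes (par j' Finₚ.≟ suc j) then pathFlow v a j' else 0ℚ) ≡ 0ℚ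
    others j' j'≢j₀ with par j' Finₚ.≟ suc j
    ... | no  _ = refl
    ... | yes p = pathFlow-off (λ r' → j'≢j₀ (path-child-unique p p₀ r' r₀))

  pathFlow-conserved : ∀ v a j → v ≢ suc j → childSum par (pathFlow v a) j ≡ pathFlow v a j
  pathFlow-conserved v a j v≢suc-j with reaches? v (suc j)
  ... | yes r  = trans (childSum-pathFlow-on v≢suc-j r) (sym (pathFlow-on r))
  ... | no  ¬r = trans (childSum-pathFlow-off ¬r) (sym (pathFlow-off ¬r))

  pathFlow-antichain : ∀ (A : Fin (suc n) → Bool) →
                       (∀ u w → A u ≡ true → A w ≡ true → ¬ ProperAnc par u w) → A zero ≡ false →
                       ∀ {v} a → A v ≡ true → Σℚ (λ j → if' (A (suc j)) (pathFlow v a j)) ≡ a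
  pathFlow-antichain A antichain A-root {zero} a Av with () ← trans (sym Av) A-root
  pathFlow-antichain A antichain A-root {suc j₀} a Av =
    trans (Σℚ-single _ j₀ others) (trans (if'-true Av) (pathFlow-on (zero , refl)))
    where
    others : ∀ j → j ≢ j₀ → if' (A (suc j)) (pathFlow (suc j₀) a j) ≡ 0ℚ
    others j j≢j₀ with A (suc j) in Aj | reaches? (suc j₀) (suc j)
    ... | false | _               = refl
    ... | true  | no ¬r            = pathFlow-off ¬r
    ... | true  | yes (zero  , e) = ⊥-elim (j≢j₀ (Finₚ.suc-injective (sym e)))
    ... | true  | yes (suc t , e) = ⊥-elim (antichain (suc j) (suc j₀) Aj Av (t , e))

  rootedSubtree-reaches : ∀ T → IsRootedSubtree par T →
                          ∀ {v u} → T v ≡ true → Reaches v u → T u ≡ true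
  rootedSubtree-reaches T (T-root , T-parent) Tv (t , refl) = walk t
    where
    up-in-T : ∀ u → T u ≡ true → T (up par u) ≡ true
    up-in-T zero    _  = T-root
    up-in-T (suc j) Tu = T-parent j Tu
    walk : ∀ t → T (iter par t _) ≡ true
    walk zero    = Tv
    walk (suc t) = up-in-T _ (walk t)

  pathFlow-≤ : ∀ T → IsRootedSubtree par T → ∀ {v a} → T v ≡ true → 0ℚ ≤ a →
               ∀ j → pathFlow v a j ≤ if' (T (suc j)) a
  pathFlow-≤ T T-rooted {v} Tv a≥0 j = if'-≤ (onPath v j)
    (λ on → ℚₚ.≤-reflexive (sym (if'-true (rootedSubtree-reaches T T-rooted Tv (onPath-sound v j on)))))
    (if'-nonneg _ a≥0)

cov≥1 : ∀ {n k} (S : Fin k → Fin (suc n) → Bool) (w : Fin k → ℚ) (T : Fin (suc n) → Bool) →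
        (∀ i → 1ℚ ≤ w i) → ∀ i → covers S T i ≡ true → 1ℚ ≤ cov S w T
cov≥1 S w T w≥1 i covered = ℚₚ.≤-trans (w≥1 i) (subst (_≤ cov S w T) (if'-true covered)
  (term≤Σℚ _ (λ i' → if'-nonneg (covers S T i') w≥0) i))
  where
  w≥0 : ∀ {i'} → 0ℚ ≤ w i'
  w≥0 {i'} = ℚₚ.≤-trans (ℚₚ.nonNegative⁻¹ 1ℚ) (w≥1 i')

module PathFlowSolution {n k : ℕ} (par : Fin n → Fin (suc n)) (tree : IsTree par)
    (S : Fin k → Fin (suc n) → Bool) (T : Fin (suc n) → Bool) (T-rooted : IsRootedSubtree par T)
    (c : ℚ) (c≥0 : 0ℚ ≤ c) where

  open RootedTree par tree

  pick : Fin k → Fin (suc n)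
  pick i = firstOr (λ v → T v ∧ S i v) zero (allFin (suc n))

  picked : ∀ i → covers S T i ≡ true → T (pick i) ≡ true × S i (pick i) ≡ true
  picked i covered = ∧-conicalˡ _ _ hit , ∧-conicalʳ _ _ hit
    where
    hit : (T (pick i) ∧ S i (pick i)) ≡ true
    hit = firstOr-satisfies _ zero (allFin (suc n)) covered

  x : Fin n → ℚ
  x j = if' (T (suc j)) c

  y : Fin k → ℚ
  y i = if' (covers S T i) c

  f : Fin k → Fin n → ℚ
  f i j = if' (covers S T i) (pathFlow (pick i) c j)

  x-nonneg : ∀ j → 0ℚ ≤ x j
  x-nonneg j = if'-nonneg (T (suc j)) c≥0

  y-nonneg : ∀ i → 0ℚ ≤ y i
  y-nonneg i = if'-nonneg (covers S T i) c≥0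

  f-nonneg : ∀ i j → 0ℚ ≤ f i j
  f-nonneg i j = if'-nonneg (covers S T i) (if'-nonneg (onPath (pick i) j) c≥0)

  x-monotone : ∀ j j' → par j ≡ suc j' → x j ≤ x j'
  x-monotone j j' p =
    if'-≤ (T (suc j)) (λ T-j → ℚₚ.≤-reflexive (sym (if'-true (T-parent T-j)))) (x-nonneg j')
    where
    T-parent : T (suc j) ≡ true → T (suc j') ≡ true
    T-parent T-j = subst (λ u → T u ≡ true) p (proj₂ T-rooted j T-j)

  f≤x : ∀ i j → f i j ≤ x j
  f≤x i j = if'-≤ (covers S T i)
    (λ covered → pathFlow-≤ T T-rooted (proj₁ (picked i covered)) c≥0 j) (x-nonneg j)

  f-conserved : ∀ i j → S i (suc j) ≡ false → f i j ≡ childSum par (f i) j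
  f-conserved i j S-j = sym (trans (childSum-if' par (covers S T i) (pathFlow (pick i) c) j)
    (if'-cong (covers S T i) (λ covered → pathFlow-conserved (pick i) c j (pick≢ covered))))
    where
    pick≢ : covers S T i ≡ true → pick i ≢ suc j
    pick≢ covered e with () ← trans (sym (subst (λ u → S i u ≡ true) e (proj₂ (picked i covered)))) S-j

  f-delivers : (∀ i u v → S i u ≡ true → S i v ≡ true → ¬ ProperAnc par u v) →
               (∀ i → S i zero ≡ false) →
               ∀ i → Σℚ (λ j → if' (S i (suc j)) (f i j)) ≡ y i
  f-delivers antichain S-root i = begin
    Σℚ (λ j → if' (S i (suc j)) (f i j))
      ≡⟨ Σℚ-cong (λ j → if'-comm (S i (suc j)) (covers S T i) _) ⟩
    Σℚ (λ j → if' (covers S T i) (delivered j))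
      ≡⟨ Σℚ-if' (covers S T i) delivered ⟩
    if' (covers S T i) (Σℚ delivered)
      ≡⟨ if'-cong (covers S T i) (λ covered →
           pathFlow-antichain (S i) (antichain i) (S-root i) c (proj₂ (picked i covered))) ⟩
    y i ∎
    where
    delivered : Fin n → ℚ
    delivered j = if' (S i (suc j)) (pathFlow (pick i) c j)

lemma9 : ∀ {n k : ℕ}
    → (par : Fin n → Fin (suc n)) → IsTree par
    → (d : Fin n → ℚ) → (∀ j → 0ℚ ≤ d j)
    → (S : Fin k → Fin (suc n) → Bool) → (w : Fin k → ℚ) → (∀ i → 1ℚ ≤ w i)
    → (∀ i i' v → S i v ≡ true → S i' v ≡ true → i ≡ i')
    → (∀ i u v → S i u ≡ true → S i v ≡ true → ¬ ProperAnc par u v)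
    → (∀ i → S i zero ≡ false)
    → (T : Fin (suc n) → Bool) → IsRootedSubtree par T
    → (∃ λ i → covers S T i ≡ true)
    → ∃ λ (x : Fin n → ℚ) → ∃ λ (f : Fin k → Fin n → ℚ) → ∃ λ (y : Fin k → ℚ) →
        (∀ j j' → par j ≡ suc j' → x j ≤ x j')
      × (∀ i j → S i (suc j) ≡ false → f i j ≡ childSum par (f i) j)
      × (∀ i → Σℚ (λ j → if' (S i (suc j)) (f i j)) ≡ y i)
      × (∀ i j → f i j ≤ x j)
      × (1ℚ ≤ Σℚ (λ i → w i * y i))
      × (∀ j → 0ℚ ≤ x j) × (∀ i j → 0ℚ ≤ f i j) × (∀ i → 0ℚ ≤ y i)
      × (Σℚ (λ j → d j * x j) ≤ ratio (dist d T) (cov S w T))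
lemma9 par tree d _ S w w≥1 _ antichain S-root T T-rooted (i₀ , i₀-covered) =
    x , f , y , x-monotone , f-conserved , f-delivers antichain S-root , f≤x , covering
  , x-nonneg , f-nonneg , y-nonneg , cost
  where
  C : ℚ
  C = cov S w T
  C>0 : 0ℚ < C
  C>0 = ℚₚ.<-≤-trans (ℚₚ.positive⁻¹ 1ℚ) (cov≥1 S w T w≥1 i₀ i₀-covered)
  c : ℚ
  c = ratio 1ℚ C
  open PathFlowSolution par tree S T T-rooted c (ratio-1-nonneg C C>0)
  covering : 1ℚ ≤ Σℚ (λ i → w i * y i)
  covering = ℚₚ.≤-reflexive (sym (trans (Σℚ-*-if' (covers S T) w c)
    (ratio-1-inverseˡ C (λ C≡0 → ℚₚ.<⇒≢ C>0 (sym C≡0)))))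
  cost : Σℚ (λ j → d j * x j) ≤ ratio (dist d T) C
  cost = ℚₚ.≤-reflexive (trans (Σℚ-*-if' (λ j → T (suc j)) d c) (ratio-1-* C (dist d T)))
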